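{- For integers $d\ge3$ and $\ell\ge1$ let $N_{d,\ell}=2\sum_{k=0}^{d-2}\binom{2k}{\ell-2}$. Then for every $d\ge3$ the sequence $(N_{d,\ell})_{\ell\ge1}$ is unimodal and $\ell=d$ is a mode of it (i.e. $N_{d,d}=\max_\ell N_{d,\ell}$). If $d\ge4$, this mode is unique.
   Context: Binomial coefficients $\binom{a}{b}$ are $0$ when $b<0$ or $b>a$. ($N_{d,\ell}$ equals the number of $\mathbf c$-monotone paths of length $\ell$ on the $d$-dimensional cross-polytope for generic $\mathbf c$.) A sequence $(a_i)$ is unimodal if there is $k$ with $a_i\le a_{i+1}$ for $i<k$ and $a_i\ge a_{i+1}$ for $i\ge k$; a mode is an index where the maximum is attained. -}

module Defs where

open import Data.Nat using (ℕ; zero; suc; _+_; _*_; _≤_; _<_)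
open import Data.Nat.Combinatorics using (_C_)
open import Data.Product using (∃; _×_)

-- Binomial coefficient binom(a, ℓ - 2) with the convention that it is 0
-- when ℓ - 2 < 0 (i.e. ℓ ∈ {0,1}); stdlib's _C_ is already 0 when b > a.
binomShift2 : ℕ → ℕ → ℕ
binomShift2 a zero = 0
binomShift2 a (suc zero) = 0
binomShift2 a (suc (suc m)) = a C m

sumBelow : ℕ → (ℕ → ℕ) → ℕ
sumBelow zero f = 0
sumBelow (suc n) f = sumBelow n f + f n

-- N_{d,ℓ} = 2 Σ_{k=0}^{d-2} binom(2k, ℓ-2)   (upper index d-2 means d-1 terms; used for d ≥ 3)
N : ℕ → ℕ → ℕ
N zero ℓ = 0
N (suc d′) ℓ = 2 * sumBelow d′ (λ k → binomShift2 (2 * k) ℓ)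

UnimodalFrom1 : (ℕ → ℕ) → Set
UnimodalFrom1 a = ∃ λ k →
  ((i : ℕ) → 1 ≤ i → i < k → a i ≤ a (suc i)) ×
  ((i : ℕ) → 1 ≤ i → k ≤ i → a (suc i) ≤ a i)

-- Write S n m = Σ_{k<n} C(2k, m), so that N_{d,m+2} = 2 S (d-1) m. Row 2k of Pascal's
-- triangle increases up to its middle k and decreases after it, so S n m decreases in m from
-- m = n - 1 on, and from m to m + 1 every row with k > m increases. For the first m + 2 rows
-- use the telescope 2 S n (m+1) + S n m = C(2n, m+2) (Pascal's rule applied twice): with the
-- symmetry of row 2n it turns S (m+2) m < S (m+2) (m+1), for m ≥ 1, into
-- S (m+1) (m+1) < S (m+1) (m-1), which holds row by row.
module Submission where

open import Defs
open import Data.Nat using (ℕ; _≤_; _<_)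
open import Data.Product using (_×_)
open import Relation.Binary.PropositionalEquality using (_≢_)

open import Data.Nat using (zero; suc; _+_; _*_; z≤n; s≤s; _≤′_; ≤′-refl; ≤′-step)
open import Data.Nat.Properties
open import Data.Nat.Combinatorics using (_C_; nCk+nC[k+1]≡[n+1]C[k+1]; nCk≡nC[n∸k]; nC1≡n)
open import Data.Nat.Tactic.RingSolver using (solve-∀)
open import Data.Product using (_,_)
open import Data.Sum using (inj₁; inj₂)
open import Relation.Binary.PropositionalEquality
  using (_≡_; refl; sym; trans; cong; cong₂; subst₂; module ≡-Reasoning)
open import Relation.Nullary using (contradiction)
open import Relation.Binary.Definitions using (tri<; tri≈; tri>)

-- Pascal's recursion, which (unlike _C_) computes by pattern matching.
binom : ℕ → ℕ → ℕ
binom n zero = 1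
binom zero (suc k) = 0
binom (suc n) (suc k) = binom n k + binom n (suc k)

binom≡C : ∀ n k → binom n k ≡ n C k
binom≡C n zero = refl
binom≡C zero (suc k) = refl
binom≡C (suc n) (suc k) =
  trans (cong₂ _+_ (binom≡C n k) (binom≡C n (suc k))) (nCk+nC[k+1]≡[n+1]C[k+1] n k)

binom-mirror : ∀ {n} a b → n ≡ a + b → binom n a ≡ binom n b
binom-mirror a b refl =
  trans (binom≡C (a + b) a)
        (trans (nCk≡nC[n∸k] (m≤m+n a b))
               (trans (cong ((a + b) C_) (m+n∸m≡n a b)) (sym (binom≡C (a + b) b))))

binom>0 : ∀ n k → k ≤ n → 0 < binom n k
binom>0 n zero _ = s≤s z≤n
binom>0 (suc n) (suc k) (s≤s k≤n) = ≤-trans (binom>0 n k k≤n) (m≤m+n _ _)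

binom-absorb : ∀ n k → suc k * binom (suc n) (suc k) ≡ suc n * binom n k
binom-absorb n zero =
  trans (*-identityˡ _) (trans (binom≡C (suc n) 1) (trans (nC1≡n (suc n)) (sym (*-identityʳ (suc n)))))
binom-absorb zero (suc k) = *-zeroʳ (suc (suc k))
binom-absorb (suc n) (suc k) = begin
  suc (suc k) * (x + y)              ≡⟨ *-distribˡ-+ (suc (suc k)) x y ⟩
  (x + suc k * x) + suc (suc k) * y  ≡⟨ cong₂ (λ s t → (x + s) + t) (binom-absorb n k) (binom-absorb n (suc k)) ⟩
  (x + suc n * u) + suc n * v        ≡⟨ regroup n u v ⟩
  suc (suc n) * (u + v)              ∎
  where
  open ≡-Reasoning
  x y u v : ℕ
  x = binom (suc n) (suc k)
  y = binom (suc n) (suc (suc k))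
  u = binom n k
  v = binom n (suc k)
  regroup : ∀ n u v → ((u + v) + suc n * u) + suc n * v ≡ suc (suc n) * (u + v)
  regroup = solve-∀

-- The ratio C(n,k+1) / C(n,k) = (n - k) / (k + 1), written without division or subtraction.
binom-ratio : ∀ n k → suc k * binom n (suc k) + k * binom n k ≡ n * binom n k
binom-ratio zero zero = refl
binom-ratio zero (suc k) = cong₂ _+_ (*-zeroʳ (suc (suc k))) (*-zeroʳ (suc k))
binom-ratio (suc n) zero = trans (+-identityʳ _) (binom-absorb n 0)
binom-ratio (suc n) (suc k) = begin
  suc (suc k) * binom (suc n) (suc (suc k)) + suc k * binom (suc n) (suc k)
    ≡⟨ cong₂ _+_ (binom-absorb n (suc k)) (binom-absorb n k) ⟩
  suc n * binom n (suc k) + suc n * binom n k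
    ≡⟨ +-comm (suc n * binom n (suc k)) _ ⟩
  suc n * binom n k + suc n * binom n (suc k)
    ≡⟨ *-distribˡ-+ (suc n) (binom n k) (binom n (suc k)) ⟨
  suc n * binom (suc n) (suc k)
    ∎
  where open ≡-Reasoning

binom-ascends : ∀ n k → suc (2 * k) ≤ n → binom n k ≤ binom n (suc k)
binom-ascends n k 2k<n = *-cancelˡ-≤ (suc k) (+-cancelʳ-≤ (k * b) _ _ (begin
  suc k * b + k * b                      ≡⟨ split k b ⟨
  suc (2 * k) * b                        ≤⟨ *-monoˡ-≤ b 2k<n ⟩
  n * b                                  ≡⟨ binom-ratio n k ⟨
  suc k * binom n (suc k) + k * b        ∎))
  where
  open ≤-Reasoning
  b : ℕ
  b = binom n k
  split : ∀ k b → suc (2 * k) * b ≡ suc k * b + k * b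
  split = solve-∀

private
  binom-descends-scaled : ∀ n k → n ≤ 2 * k → suc k * binom n (suc k) ≤ k * binom n k
  binom-descends-scaled n k n≤2k = +-cancelʳ-≤ (k * b) _ _ (begin
    suc k * binom n (suc k) + k * b    ≡⟨ binom-ratio n k ⟩
    n * b                              ≤⟨ *-monoˡ-≤ b n≤2k ⟩
    2 * k * b                          ≡⟨ split k b ⟩
    k * b + k * b                      ∎)
    where
    open ≤-Reasoning
    b : ℕ
    b = binom n k
    split : ∀ k b → 2 * k * b ≡ k * b + k * b
    split = solve-∀

binom-descends : ∀ n k → n ≤ 2 * k → binom n (suc k) ≤ binom n k
binom-descends n k n≤2k =
  *-cancelˡ-≤ (suc k) (≤-trans (binom-descends-scaled n k n≤2k) (m≤n+m (k * binom n k) (binom n k)))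

binom-descends-strictly : ∀ n k → n ≤ 2 * k → k ≤ n → binom n (suc k) < binom n k
binom-descends-strictly n k n≤2k k≤n = *-cancelˡ-< (suc k) _ _
  (≤-<-trans (binom-descends-scaled n k n≤2k) (+-monoˡ-< (k * binom n k) (binom>0 n k k≤n)))

sumBelow-cong : ∀ n {f g : ℕ → ℕ} → (∀ k → f k ≡ g k) → sumBelow n f ≡ sumBelow n g
sumBelow-cong zero f≗g = refl
sumBelow-cong (suc n) f≗g = cong₂ _+_ (sumBelow-cong n f≗g) (f≗g n)

sumBelow-zero : ∀ n → sumBelow n (λ _ → 0) ≡ 0
sumBelow-zero zero = refl
sumBelow-zero (suc n) = trans (+-identityʳ _) (sumBelow-zero n)

sumBelow-mono-≤ : ∀ n {f g : ℕ → ℕ} → (∀ k → k < n → f k ≤ g k) → sumBelow n f ≤ sumBelow n g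
sumBelow-mono-≤ zero f≤g = z≤n
sumBelow-mono-≤ (suc n) f≤g =
  +-mono-≤ (sumBelow-mono-≤ n (λ k k<n → f≤g k (m<n⇒m<1+n k<n))) (f≤g n ≤-refl)

module _ {f g : ℕ → ℕ} {p : ℕ} (f≤g-from-p : ∀ k → p ≤ k → f k ≤ g k) where

  sumBelow-mono-≤-from : ∀ {n} → p ≤′ n → sumBelow p f ≤ sumBelow p g → sumBelow n f ≤ sumBelow n g
  sumBelow-mono-≤-from ≤′-refl below = below
  sumBelow-mono-≤-from (≤′-step p≤n) below =
    +-mono-≤ (sumBelow-mono-≤-from p≤n below) (f≤g-from-p _ (≤′⇒≤ p≤n))

  sumBelow-mono-<-from : ∀ {n} → p ≤′ n → sumBelow p f < sumBelow p g → sumBelow n f < sumBelow n g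
  sumBelow-mono-<-from ≤′-refl below = below
  sumBelow-mono-<-from (≤′-step p≤n) below =
    +-mono-<-≤ (sumBelow-mono-<-from p≤n below) (f≤g-from-p _ (≤′⇒≤ p≤n))

evenRowSum : ℕ → ℕ → ℕ
evenRowSum n m = sumBelow n (λ k → binom (2 * k) m)

private
  2*-suc : ∀ m → 2 * suc m ≡ suc (suc (2 * m))
  2*-suc m = *-suc 2 m

  n≤2n : ∀ n → n ≤ 2 * n
  n≤2n n = m≤n*m n 2

  1+2m≤2n : ∀ {m n} → m < n → suc (2 * m) ≤ 2 * n
  1+2m≤2n {m} m<n = ≤-trans (≤-trans (n≤1+n _) (≤-reflexive (sym (2*-suc m)))) (*-monoʳ-≤ 2 m<n)

evenRowSum-telescope : ∀ n m → 2 * evenRowSum n (suc m) + evenRowSum n m ≡ binom (2 * n) (suc (suc m))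
evenRowSum-telescope zero m = refl
evenRowSum-telescope (suc n) m = begin
  2 * (S₁ + b₁) + (S₀ + b₀)        ≡⟨ regroup S₁ S₀ b₀ b₁ ⟩
  (b₀ + b₁) + (b₁ + (2 * S₁ + S₀)) ≡⟨ cong (λ t → (b₀ + b₁) + (b₁ + t)) (evenRowSum-telescope n m) ⟩
  binom (suc (suc (2 * n))) (suc (suc m)) ≡⟨ cong (λ r → binom r (suc (suc m))) (2*-suc n) ⟨
  binom (2 * suc n) (suc (suc m))  ∎
  where
  open ≡-Reasoning
  S₀ S₁ b₀ b₁ : ℕ
  S₀ = evenRowSum n m
  S₁ = evenRowSum n (suc m)
  b₀ = binom (2 * n) m
  b₁ = binom (2 * n) (suc m)
  regroup : ∀ a b p q → 2 * (a + q) + (b + p) ≡ (p + q) + (q + (2 * a + b))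
  regroup = solve-∀

evenRowSum-descends : ∀ n m → n ≤ suc m → evenRowSum n (suc m) ≤ evenRowSum n m
evenRowSum-descends n m n≤1+m = sumBelow-mono-≤ n (λ k k<n →
  binom-descends (2 * k) m (*-monoʳ-≤ 2 (≤-pred (≤-trans k<n n≤1+m))))

evenRowSum-descends-strictly : ∀ n → evenRowSum (suc n) (suc n) < evenRowSum (suc n) n
evenRowSum-descends-strictly n =
  +-mono-≤-< (evenRowSum-descends n n (n≤1+n n)) (binom-descends-strictly (2 * n) n ≤-refl (n≤2n n))

evenRowSum-diagonal< : ∀ i → evenRowSum (2 + i) (2 + i) < evenRowSum (2 + i) i
evenRowSum-diagonal< i = +-mono-<-≤ (+-mono-≤-< rows<i row-i) row-1+i
  where
  rows<i : evenRowSum i (2 + i) ≤ evenRowSum i i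
  rows<i = sumBelow-mono-≤ i (λ k k<i → ≤-trans
    (binom-descends (2 * k) (suc i) (*-monoʳ-≤ 2 (≤-trans (<⇒≤ k<i) (n≤1+n i))))
    (binom-descends (2 * k) i (*-monoʳ-≤ 2 (<⇒≤ k<i))))
  row-i : binom (2 * i) (2 + i) < binom (2 * i) i
  row-i = ≤-<-trans (binom-descends (2 * i) (suc i) (*-monoʳ-≤ 2 (n≤1+n i)))
                    (binom-descends-strictly (2 * i) i ≤-refl (n≤2n i))
  row-1+i : binom (2 * suc i) (2 + i) ≤ binom (2 * suc i) i
  row-1+i = ≤-reflexive (sym (binom-mirror i (2 + i) (split i)))
    where
    split : ∀ i → 2 * suc i ≡ i + (2 + i)
    split = solve-∀

evenRowSum-ascends-at-3+i : ∀ i → evenRowSum (3 + i) (1 + i) < evenRowSum (3 + i) (2 + i)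
evenRowSum-ascends-at-3+i i = reduce
  (trans (binom-mirror (1 + i) (3 + i) (split i)) (sym (evenRowSum-telescope (2 + i) (suc i))))
  (sym (evenRowSum-telescope (2 + i) i))
  (evenRowSum-diagonal< i)
  where
  split : ∀ i → 2 * (2 + i) ≡ (1 + i) + (3 + i)
  split = solve-∀
  reduce : ∀ {a b c P Q} → P ≡ 2 * a + b → Q ≡ 2 * b + c → a < c → b + P < a + Q
  reduce {a} {b} refl refl a<c = subst₂ _<_ (regroupˡ a b) (regroupʳ a b _) (+-monoʳ-< (a + 2 * b) a<c)
    where
    regroupˡ : ∀ a b → (a + 2 * b) + a ≡ b + (2 * a + b)
    regroupˡ = solve-∀
    regroupʳ : ∀ a b c → (a + 2 * b) + c ≡ a + (2 * b + c)
    regroupʳ = solve-∀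

evenRowSum-ascends-strictly : ∀ n m → 1 ≤ m → 2 + m ≤ n → evenRowSum n m < evenRowSum n (suc m)
evenRowSum-ascends-strictly n (suc i) _ 3+i≤n =
  sumBelow-mono-<-from (λ k 3+i≤k → binom-ascends (2 * k) (suc i) (1+2m≤2n (≤-trans (n≤1+n _) 3+i≤k)))
                       (≤⇒≤′ 3+i≤n) (evenRowSum-ascends-at-3+i i)

evenRowSum-ascends : ∀ n m → 2 + m ≤ n → evenRowSum n m ≤ evenRowSum n (suc m)
evenRowSum-ascends n zero 2≤n =
  sumBelow-mono-≤-from (λ k 2≤k → binom-ascends (2 * k) 0 (1+2m≤2n (≤-trans (s≤s z≤n) 2≤k)))
                       (≤⇒≤′ 2≤n) ≤-refl
evenRowSum-ascends n (suc i) 3+i≤n = <⇒≤ (evenRowSum-ascends-strictly n (suc i) (s≤s z≤n) 3+i≤n)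

N-1 : ∀ n → N (suc n) 1 ≡ 0
N-1 n = cong (2 *_) (sumBelow-zero n)

N-2+m : ∀ n m → N (suc n) (2 + m) ≡ 2 * evenRowSum n m
N-2+m n m = cong (2 *_) (sumBelow-cong n (λ k → sym (binom≡C (2 * k) m)))

N-ascends : ∀ n i → 1 ≤ i → i < suc n → N (suc n) i ≤ N (suc n) (suc i)
N-ascends n 1 _ _ = ≤-trans (≤-reflexive (N-1 n)) z≤n
N-ascends n (suc (suc m)) _ (s≤s 2+m≤n) = subst₂ _≤_ (sym (N-2+m n m)) (sym (N-2+m n (suc m)))
  (*-monoʳ-≤ 2 (evenRowSum-ascends n m 2+m≤n))

N-descends : ∀ n i → 1 ≤ i → suc n ≤ i → N (suc n) (suc i) ≤ N (suc n) i
N-descends zero 1 _ _ = ≤-refl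
N-descends n (suc (suc m)) _ (s≤s n≤1+m) = subst₂ _≤_ (sym (N-2+m n (suc m))) (sym (N-2+m n m))
  (*-monoʳ-≤ 2 (evenRowSum-descends n m n≤1+m))

N-ascends-strictly-to-peak : ∀ p → 1 ≤ p → N (3 + p) (2 + p) < N (3 + p) (3 + p)
N-ascends-strictly-to-peak p 1≤p = subst₂ _<_ (sym (N-2+m (2 + p) p)) (sym (N-2+m (2 + p) (suc p)))
  (*-monoʳ-< 2 (evenRowSum-ascends-strictly (2 + p) p 1≤p ≤-refl))

N-descends-strictly-from-peak : ∀ p → N (3 + p) (4 + p) < N (3 + p) (3 + p)
N-descends-strictly-from-peak p = subst₂ _<_ (sym (N-2+m (2 + p) (2 + p))) (sym (N-2+m (2 + p) (suc p)))
  (*-monoʳ-< 2 (evenRowSum-descends-strictly (suc p)))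

module _ (a : ℕ → ℕ) where

  ascent⇒≤ : ∀ {i j} → i ≤′ j → (∀ m → i ≤ m → m < j → a m ≤ a (suc m)) → a i ≤ a j
  ascent⇒≤ ≤′-refl _ = ≤-refl
  ascent⇒≤ (≤′-step i≤j) up =
    ≤-trans (ascent⇒≤ i≤j (λ m i≤m m<j → up m i≤m (m<n⇒m<1+n m<j))) (up _ (≤′⇒≤ i≤j) ≤-refl)

  descent⇒≥ : ∀ {i j} → i ≤′ j → (∀ m → i ≤ m → m < j → a (suc m) ≤ a m) → a j ≤ a i
  descent⇒≥ ≤′-refl _ = ≤-refl
  descent⇒≥ (≤′-step i≤j) down =
    ≤-trans (down _ (≤′⇒≤ i≤j) ≤-refl) (descent⇒≥ i≤j (λ m i≤m m<j → down m i≤m (m<n⇒m<1+n m<j)))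

  module _ {k : ℕ}
           (up : ∀ i → 1 ≤ i → i < k → a i ≤ a (suc i))
           (down : ∀ i → 1 ≤ i → k ≤ i → a (suc i) ≤ a i) where

    unimodal-mode : 1 ≤ k → ∀ ℓ → 1 ≤ ℓ → a ℓ ≤ a k
    unimodal-mode 1≤k ℓ 1≤ℓ with ≤-total ℓ k
    ... | inj₁ ℓ≤k = ascent⇒≤ (≤⇒≤′ ℓ≤k) (λ m ℓ≤m m<k → up m (≤-trans 1≤ℓ ℓ≤m) m<k)
    ... | inj₂ k≤ℓ = descent⇒≥ (≤⇒≤′ k≤ℓ) (λ m k≤m _ → down m (≤-trans 1≤k k≤m) k≤m)

    unimodal-unique-mode : ∀ {k′} → k ≡ suc k′ → a k′ < a k → a (suc k) < a k →
                           ∀ ℓ → 1 ≤ ℓ → ℓ ≢ k → a ℓ < a k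
    unimodal-unique-mode refl left right ℓ 1≤ℓ ℓ≢k with <-cmp ℓ k
    ... | tri< ℓ<k _ _ = ≤-<-trans
      (ascent⇒≤ (≤⇒≤′ (≤-pred ℓ<k)) (λ m ℓ≤m m<k′ → up m (≤-trans 1≤ℓ ℓ≤m) (m<n⇒m<1+n m<k′))) left
    ... | tri≈ _ ℓ≡k _ = contradiction ℓ≡k ℓ≢k
    ... | tri> _ _ k<ℓ = ≤-<-trans
      (descent⇒≥ (≤⇒≤′ k<ℓ) (λ m k<m _ → down m (≤-trans (s≤s z≤n) k<m) (<⇒≤ k<m))) right

lemma3p3 : (d : ℕ) → 3 ≤ d →
    UnimodalFrom1 (N d)
    × ((ℓ : ℕ) → 1 ≤ ℓ → N d ℓ ≤ N d d)
    × (4 ≤ d → (ℓ : ℕ) → 1 ≤ ℓ → ℓ ≢ d → N d ℓ < N d d)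
lemma3p3 1 (s≤s ())
lemma3p3 2 (s≤s (s≤s ()))
lemma3p3 (suc (suc (suc p))) _ =
    (3 + p , up , down)
  , unimodal-mode (N (3 + p)) up down (s≤s z≤n)
  , λ { (s≤s (s≤s (s≤s 1≤p))) → unimodal-unique-mode (N (3 + p)) up down refl
          (N-ascends-strictly-to-peak p 1≤p) (N-descends-strictly-from-peak p) }
  where
  up : ∀ i → 1 ≤ i → i < 3 + p → N (3 + p) i ≤ N (3 + p) (suc i)
  up = N-ascends (2 + p)
  down : ∀ i → 1 ≤ i → 3 + p ≤ i → N (3 + p) (suc i) ≤ N (3 + p) i
  down = N-descends (2 + p)
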